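{- Let $n\ge1$ have binary expansion $n_k\cdots n_1n_0$ with $n_k=1$. Then the number $\sigma(n)$ of $S$-nodes in the divide-and-conquer tree with $n$ leaves is $$\sigma(n)=\sum_{i=0}^{\lfloor\log_2(n)\rfloor}\beta_i(n),\qquad \beta_i(n)=\begin{cases}2^i-(n\bmod 2^i), & n_i=0,\\ n\bmod 2^i, & n_i=1,\end{cases}$$ and explicitly $$\sigma(n)=\sum_{i=0}^{\lfloor\log_2(n)\rfloor}\left[\left(\left(\left\lfloor\tfrac{n}{2^i}\right\rfloor+1\right)\bmod 2\right)2^i+(-1)^{\left(\left\lfloor\frac{n}{2^i}\right\rfloor+1\right)\bmod 2}\,(n\bmod 2^i)\right].$$
   Context: A full binary tree is a rooted tree in which every node has $0$ or $2$ children. An internal node is an $S$-node if its two children have the same number of descendant leaves. A divide-and-conquer tree is a full binary tree in which, at every internal node, the numbers of leaves of the left and right subtrees differ by at most $1$; it is unique up to isomorphism for each number of leaves. -}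

module Defs where

open import Data.Nat using (ℕ; zero; suc; _+_; _*_; _∸_; _^_; _≤_; _/_; _%_)
open import Data.Nat.Properties using (m^n≢0)
open import Data.Nat.Logarithm using (⌊log₂_⌋)
open import Data.List using (List; map; upTo)
open import Data.Nat.ListAction using (sum)
open import Data.Product using (_×_)
open import Data.Unit using (⊤)
import Data.Integer as ℤ
open ℤ using (ℤ)

data Tree : Set where
  leaf : Tree
  node : Tree → Tree → Tree

leaves : Tree → ℕ
leaves leaf = 1
leaves (node l r) = leaves l + leaves r

eqb : ℕ → ℕ → ℕ
eqb zero zero = 1
eqb zero (suc _) = 0
eqb (suc _) zero = 0
eqb (suc m) (suc n) = eqb m n

sNodes : Tree → ℕ
sNodes leaf = 0
sNodes (node l r) = eqb (leaves l) (leaves r) + sNodes l + sNodes r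

IsDC : Tree → Set
IsDC leaf = ⊤
IsDC (node l r) = (leaves l ≤ suc (leaves r)) × (leaves r ≤ suc (leaves l)) × IsDC l × IsDC r

_mod2^_ : ℕ → ℕ → ℕ
n mod2^ i = _%_ n (2 ^ i) {{m^n≢0 2 i}}

_div2^_ : ℕ → ℕ → ℕ
n div2^ i = _/_ n (2 ^ i) {{m^n≢0 2 i}}

bit : ℕ → ℕ → ℕ
bit n i = (n div2^ i) % 2

β : ℕ → ℕ → ℕ
β i n with bit n i
... | zero = 2 ^ i ∸ (n mod2^ i)
... | suc _ = n mod2^ i

Σlog : ℕ → (ℕ → ℕ) → ℕ
Σlog n f = sum (map f (upTo (suc ⌊log₂ n ⌋)))

ΣlogZ : ℕ → (ℕ → ℤ) → ℤ
ΣlogZ n f = Data.List.foldr ℤ._+_ (ℤ.+ 0) (map f (upTo (suc ⌊log₂ n ⌋)))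

explicitTerm : ℕ → ℕ → ℤ
explicitTerm n i =
  (ℤ.+ (((n div2^ i) + 1) % 2)) ℤ.* (ℤ.+ (2 ^ i))
  ℤ.+ ((ℤ.-[1+ 0 ] ℤ.^ (((n div2^ i) + 1) % 2)) ℤ.* (ℤ.+ (n mod2^ i)))

{-# OPTIONS --safe #-}
module Submission where

-- Count S-nodes level by level. The divide-and-conquer tree with n ≥ 2 leaves has subtrees with
-- ⌈n/2⌉ and ⌊n/2⌋ leaves, so the number s_d(n) of S-nodes at depth d satisfies
-- s_0(n) = [n even] and s_{d+1}(n) = s_d(⌈n/2⌉) + s_d(⌊n/2⌋). The β_i obey the same recurrence:
-- writing ⌊n/2⌋ = r + q·2^i with r < 2^i, one has ⌈n/2⌉ = s + q·2^i with s ∈ {r, r+1} and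
-- n = (r + s) + q·2^(i+1), so β_{i+1}(n), β_i(⌈n/2⌉) and β_i(⌊n/2⌋) are all governed by the
-- digit q mod 2 (also when s = 2^i and the digit of ⌈n/2⌉ flips), and the recurrence reduces to
-- 2^(i+1) − (r + s) = (2^i − s) + (2^i − r). Hence s_d(n) = β_d(n) whenever 2^d ≤ n, i.e. for
-- all d ≤ ⌊log₂ n⌋, and there are no internal nodes below depth ⌊log₂ n⌋.

open import Defs
open import Data.Nat using (ℕ; zero; suc; _+_; _*_; _∸_; _^_; _≤_; _<_; _%_; _⊔_; ⌊_/2⌋; ⌈_/2⌉; z≤n; s≤s; z<s; s<s)
open import Data.Nat.Properties
open import Data.Nat.DivMod
open import Data.Nat.Divisibility using (divides-refl)
open import Data.Nat.Logarithm using (⌊log₂_⌋; ⌊log₂⌋-mono-≤; ⌊log₂[2^n]⌋≡n)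
open import Data.Nat.Logarithm.Core using (⌊log2⌋)
open import Data.Nat.ListAction using (sum)
open import Data.Nat.Solver using (module +-*-Solver)
open import Data.List using ([]; _∷_; map; foldr; applyUpTo; upTo)
open import Data.List.Properties using (map-cong; map-upTo)
open import Data.Product using (_×_; _,_; ∃₂)
open import Data.Sum using (_⊎_; inj₁; inj₂)
open import Function using (_∘_)
open import Induction.WellFounded using (Acc; acc)
open import Relation.Nullary using (contradiction)
open import Relation.Binary.PropositionalEquality
import Data.Integer as ℤ
import Data.Integer.Properties as ℤP
open ℤ using (ℤ; +_)
open +-*-Solver using (solve; _:+_; _:*_; _:=_; con)

2^[1+i]≡2^i+2^i : ∀ i → 2 ^ suc i ≡ 2 ^ i + 2 ^ i
2^[1+i]≡2^i+2^i i = cong (λ m → 2 ^ i + m) (+-identityʳ (2 ^ i))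

[m+n]∸[o+p]≡[m∸o]+[n∸p] : ∀ {m n o p} → o ≤ m → p ≤ n → (m + n) ∸ (o + p) ≡ (m ∸ o) + (n ∸ p)
[m+n]∸[o+p]≡[m∸o]+[n∸p] {m} {n} {o} {p} o≤m p≤n = begin
  (m + n) ∸ (o + p)  ≡⟨ ∸-+-assoc (m + n) o p ⟨
  (m + n) ∸ o ∸ p    ≡⟨ cong (_∸ p) (+-∸-comm n o≤m) ⟩
  (m ∸ o) + n ∸ p    ≡⟨ +-∸-assoc (m ∸ o) p≤n ⟩
  (m ∸ o) + (n ∸ p)  ∎
  where open ≡-Reasoning

quotRem2^ : ∀ i b → ∃₂ λ r q → r < 2 ^ i × b ≡ r + q * 2 ^ i
quotRem2^ i b = b mod2^ i , b div2^ i , m%n<n b (2 ^ i) , m≡m%n+[m/n]*n b (2 ^ i)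
  where instance 2^i≢0 = m^n≢0 2 i

[r+q*2^i]mod2^i≡r : ∀ {i r} q → r < 2 ^ i → (r + q * 2 ^ i) mod2^ i ≡ r
[r+q*2^i]mod2^i≡r {i} {r} q r< = trans ([m+kn]%n≡m%n r q (2 ^ i)) (m<n⇒m%n≡m r<)
  where instance 2^i≢0 = m^n≢0 2 i

[r+q*2^i]div2^i≡q : ∀ {i r} q → r < 2 ^ i → (r + q * 2 ^ i) div2^ i ≡ q
[r+q*2^i]div2^i≡q {i} {r} q r< = begin
  (r + q * 2 ^ i) / 2 ^ i        ≡⟨ +-distrib-/-∣ʳ r (divides-refl q) ⟩
  r / 2 ^ i + q * 2 ^ i / 2 ^ i  ≡⟨ cong₂ _+_ (m<n⇒m/n≡0 r<) (m*n/n≡m q (2 ^ i)) ⟩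
  q                              ∎
  where
  open ≡-Reasoning
  instance 2^i≢0 = m^n≢0 2 i

β′ : ℕ → ℕ → ℕ → ℕ
β′ zero    i r = 2 ^ i ∸ r
β′ (suc _) i r = r

β≡β′ : ∀ i n → β i n ≡ β′ (bit n i) i (n mod2^ i)
β≡β′ i n with bit n i
... | zero  = refl
... | suc _ = refl

β-split : ∀ {i r} q → r < 2 ^ i → β i (r + q * 2 ^ i) ≡ β′ (q % 2) i r
β-split {i} q r< = trans (β≡β′ i _)
  (cong₂ (λ q′ r′ → β′ (q′ % 2) i r′) ([r+q*2^i]div2^i≡q {i} q r<) ([r+q*2^i]mod2^i≡r {i} q r<))

β′-top : ∀ q i → β′ (suc q % 2) i 0 ≡ β′ (q % 2) i (2 ^ i)
β′-top zero          i = sym (n∸n≡0 (2 ^ i))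
β′-top (suc zero)    i = refl
β′-top (suc (suc q)) i = β′-top q i

β-split≤ : ∀ {i s} q → s ≤ 2 ^ i → β i (s + q * 2 ^ i) ≡ β′ (q % 2) i s
β-split≤ {i} q s≤ with m≤n⇒m<n∨m≡n s≤
... | inj₁ s<   = β-split {i} q s<
... | inj₂ refl = trans (β-split {i} (suc q) (m^n>0 2 i)) (β′-top q i)

β′-+ : ∀ p {i r s} → r ≤ 2 ^ i → s ≤ 2 ^ i → β′ p (suc i) (r + s) ≡ β′ p i s + β′ p i r
β′-+ zero {i} {r} {s} r≤ s≤ = begin
  2 ^ suc i ∸ (r + s)        ≡⟨ cong (_∸ (r + s)) (2^[1+i]≡2^i+2^i i) ⟩
  (2 ^ i + 2 ^ i) ∸ (r + s)  ≡⟨ [m+n]∸[o+p]≡[m∸o]+[n∸p] r≤ s≤ ⟩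
  (2 ^ i ∸ r) + (2 ^ i ∸ s)  ≡⟨ +-comm (2 ^ i ∸ r) _ ⟩
  (2 ^ i ∸ s) + (2 ^ i ∸ r)  ∎
  where open ≡-Reasoning
β′-+ (suc _) {r = r} _ _ = +-comm r _

β-suc-sameQuotient : ∀ {i r s} q → r < 2 ^ i → s ≤ 2 ^ i →
  β (suc i) ((r + q * 2 ^ i) + (s + q * 2 ^ i)) ≡ β i (s + q * 2 ^ i) + β i (r + q * 2 ^ i)
β-suc-sameQuotient {i} {r} {s} q r< s≤ = begin
  β (suc i) ((r + q * 2 ^ i) + (s + q * 2 ^ i))  ≡⟨ cong (β (suc i)) regroup ⟩
  β (suc i) ((r + s) + q * 2 ^ suc i)            ≡⟨ β-split q r+s< ⟩
  β′ (q % 2) (suc i) (r + s)                     ≡⟨ β′-+ (q % 2) (<⇒≤ r<) s≤ ⟩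
  β′ (q % 2) i s + β′ (q % 2) i r                ≡⟨ cong₂ _+_ (β-split≤ q s≤) (β-split q r<) ⟨
  β i (s + q * 2 ^ i) + β i (r + q * 2 ^ i)      ∎
  where
  open ≡-Reasoning
  regroup : (r + q * 2 ^ i) + (s + q * 2 ^ i) ≡ (r + s) + q * 2 ^ suc i
  regroup = solve 4 (λ r s q x → (r :+ q :* x) :+ (s :+ q :* x) := (r :+ s) :+ q :* (con 2 :* x))
                    refl r s q (2 ^ i)
  r+s< : r + s < 2 ^ suc i
  r+s< = subst (r + s <_) (sym (2^[1+i]≡2^i+2^i i)) (+-mono-<-≤ r< s≤)

β-suc-+ : ∀ i {b c} → c ≡ b ⊎ c ≡ suc b → β (suc i) (b + c) ≡ β i c + β i b
β-suc-+ i {b} c≡ with quotRem2^ i b | c≡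
... | r , q , r< , refl | inj₁ refl = β-suc-sameQuotient {i} q r< (<⇒≤ r<)
... | r , q , r< , refl | inj₂ refl = β-suc-sameQuotient {i} q r< r<

⌈n/2⌉≡⌊n/2⌋⊎1+⌊n/2⌋ : ∀ n → ⌈ n /2⌉ ≡ ⌊ n /2⌋ ⊎ ⌈ n /2⌉ ≡ suc ⌊ n /2⌋
⌈n/2⌉≡⌊n/2⌋⊎1+⌊n/2⌋ zero          = inj₁ refl
⌈n/2⌉≡⌊n/2⌋⊎1+⌊n/2⌋ (suc zero)    = inj₂ refl
⌈n/2⌉≡⌊n/2⌋⊎1+⌊n/2⌋ (suc (suc n)) with ⌈n/2⌉≡⌊n/2⌋⊎1+⌊n/2⌋ n
... | inj₁ e = inj₁ (cong suc e)
... | inj₂ e = inj₂ (cong suc e)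

β-suc : ∀ i n → β (suc i) n ≡ β i ⌈ n /2⌉ + β i ⌊ n /2⌋
β-suc i n = trans (cong (β (suc i)) (sym (⌊n/2⌋+⌈n/2⌉≡n n))) (β-suc-+ i (⌈n/2⌉≡⌊n/2⌋⊎1+⌊n/2⌋ n))

β-zero : ∀ n → β 0 n ≡ β′ (n % 2) 0 0
β-zero n = trans (cong (β 0) (sym (*-identityʳ n))) (β-split n (m^n>0 2 0))

eqb-halves : ∀ n → eqb ⌈ n /2⌉ ⌊ n /2⌋ ≡ β′ (n % 2) 0 0
eqb-halves zero          = refl
eqb-halves (suc zero)    = refl
eqb-halves (suc (suc n)) = eqb-halves n

-- sAt d n is the number of S-nodes at depth d of the divide-and-conquer tree with n leaves.
sAt : ℕ → ℕ → ℕ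
sAt zero    n                  = eqb ⌈ n /2⌉ ⌊ n /2⌋
sAt (suc d) zero               = 0
sAt (suc d) (suc zero)         = 0
sAt (suc d) n@(suc (suc _))    = sAt d ⌈ n /2⌉ + sAt d ⌊ n /2⌋

sAt-1 : ∀ d → sAt d 1 ≡ 0
sAt-1 zero    = refl
sAt-1 (suc d) = refl

sAt-suc : ∀ d {n} → 2 ≤ n → sAt (suc d) n ≡ sAt d ⌈ n /2⌉ + sAt d ⌊ n /2⌋
sAt-suc d {suc (suc _)} _ = refl
sAt-suc d {suc zero}    (s≤s ())

⌊2^[1+d]/2⌋≡2^d : ∀ d → ⌊ 2 ^ suc d /2⌋ ≡ 2 ^ d
⌊2^[1+d]/2⌋≡2^d d = trans (cong ⌊_/2⌋ (2^[1+i]≡2^i+2^i d)) (sym (n≡⌊n+n/2⌋ (2 ^ d)))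

⌈2^[1+d]/2⌉≡2^d : ∀ d → ⌈ 2 ^ suc d /2⌉ ≡ 2 ^ d
⌈2^[1+d]/2⌉≡2^d d = trans (cong ⌈_/2⌉ (2^[1+i]≡2^i+2^i d)) (sym (n≡⌈n+n/2⌉ (2 ^ d)))

sAt≡β : ∀ d n → 2 ^ d ≤ n → sAt d n ≡ β d n
sAt≡β zero    n _         = trans (eqb-halves n) (sym (β-zero n))
sAt≡β (suc d) n 2^[1+d]≤n = begin
  sAt (suc d) n                    ≡⟨ sAt-suc d (≤-trans (*-monoʳ-≤ 2 (m^n>0 2 d)) 2^[1+d]≤n) ⟩
  sAt d ⌈ n /2⌉ + sAt d ⌊ n /2⌋  ≡⟨ cong₂ _+_ (sAt≡β d _ (≤-trans 2^d≤⌊n/2⌋ (⌊n/2⌋≤⌈n/2⌉ n)))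
                                               (sAt≡β d _ 2^d≤⌊n/2⌋) ⟩
  β d ⌈ n /2⌉ + β d ⌊ n /2⌋      ≡⟨ β-suc d n ⟨
  β (suc d) n                      ∎
  where
  open ≡-Reasoning
  2^d≤⌊n/2⌋ : 2 ^ d ≤ ⌊ n /2⌋
  2^d≤⌊n/2⌋ = subst (_≤ ⌊ n /2⌋) (⌊2^[1+d]/2⌋≡2^d d) (⌊n/2⌋-mono 2^[1+d]≤n)

sum-applyUpTo-cong : ∀ {f g : ℕ → ℕ} D → (∀ d → d < D → f d ≡ g d) →
  sum (applyUpTo f D) ≡ sum (applyUpTo g D)
sum-applyUpTo-cong zero    _   = refl
sum-applyUpTo-cong (suc D) f≡g = cong₂ _+_ (f≡g 0 z<s) (sum-applyUpTo-cong D (λ d → f≡g (suc d) ∘ s<s))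

sum-applyUpTo-+ : ∀ (f g : ℕ → ℕ) D →
  sum (applyUpTo (λ d → f d + g d) D) ≡ sum (applyUpTo f D) + sum (applyUpTo g D)
sum-applyUpTo-+ f g zero    = refl
sum-applyUpTo-+ f g (suc D) =
  trans (cong (λ m → f 0 + g 0 + m) (sum-applyUpTo-+ (f ∘ suc) (g ∘ suc) D))
        (solve 4 (λ a b x y → (a :+ b) :+ (x :+ y) := (a :+ x) :+ (b :+ y)) refl (f 0) (g 0) _ _)

sum-applyUpTo-0 : ∀ {f : ℕ → ℕ} D → (∀ d → f d ≡ 0) → sum (applyUpTo f D) ≡ 0
sum-applyUpTo-0 zero    _   = refl
sum-applyUpTo-0 (suc D) f≡0 = cong₂ _+_ (f≡0 0) (sum-applyUpTo-0 D (f≡0 ∘ suc))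

balanced-halves : ∀ {x y} → x ≤ suc y → y ≤ suc x →
  (x ≡ ⌈ x + y /2⌉ × y ≡ ⌊ x + y /2⌋) ⊎ (x ≡ ⌊ x + y /2⌋ × y ≡ ⌈ x + y /2⌉)
balanced-halves {zero}        {zero}        _ _ = inj₁ (refl , refl)
balanced-halves {zero}        {suc zero}    _ _ = inj₂ (refl , refl)
balanced-halves {suc zero}    {zero}        _ _ = inj₁ (refl , refl)
balanced-halves {zero}        {suc (suc _)} _ (s≤s ())
balanced-halves {suc (suc _)} {zero}        (s≤s ()) _
balanced-halves {suc x}       {suc y}       x≤ y≤
  with balanced-halves {x} {y} (≤-pred x≤) (≤-pred y≤) | +-suc x y
... | inj₁ (a , b) | eq rewrite eq = inj₁ (cong suc a , cong suc b)
... | inj₂ (a , b) | eq rewrite eq = inj₂ (cong suc a , cong suc b)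

balanced-sym : (f : ℕ → ℕ → ℕ) → (∀ u v → f u v ≡ f v u) → ∀ {x y} → x ≤ suc y → y ≤ suc x →
  f x y ≡ f ⌈ x + y /2⌉ ⌊ x + y /2⌋
balanced-sym f f-sym {x} {y} x≤ y≤ with balanced-halves x≤ y≤
... | inj₁ (a , b) = cong₂ f a b
... | inj₂ (a , b) = trans (f-sym x y) (cong₂ f b a)

balanced-⊔≡⌈/2⌉ : ∀ {x y} → x ≤ suc y → y ≤ suc x → x ⊔ y ≡ ⌈ x + y /2⌉
balanced-⊔≡⌈/2⌉ {x} {y} x≤ y≤ =
  trans (balanced-sym _⊔_ ⊔-comm x≤ y≤) (m≥n⇒m⊔n≡m (⌊n/2⌋≤⌈n/2⌉ (x + y)))

eqb-sym : ∀ x y → eqb x y ≡ eqb y x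
eqb-sym zero    zero    = refl
eqb-sym zero    (suc y) = refl
eqb-sym (suc x) zero    = refl
eqb-sym (suc x) (suc y) = eqb-sym x y

leaves≥1 : ∀ t → 1 ≤ leaves t
leaves≥1 leaf       = ≤-refl
leaves≥1 (node l r) = ≤-trans (leaves≥1 l) (m≤m+n _ _)

sNodes≡ΣsAt : ∀ D t → IsDC t → leaves t ≤ 2 ^ D →
  sNodes t ≡ sum (applyUpTo (λ d → sAt d (leaves t)) D)
sNodes≡ΣsAt D       leaf       _ _   = sym (sum-applyUpTo-0 D sAt-1)
sNodes≡ΣsAt zero    (node l r) _ n≤1 =
  contradiction n≤1 (<⇒≱ (+-mono-≤ (leaves≥1 l) (leaves≥1 r)))
sNodes≡ΣsAt (suc D) (node l r) (x≤ , y≤ , dc-l , dc-r) n≤ = begin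
  eqb x y + sNodes l + sNodes r          ≡⟨ +-assoc (eqb x y) _ _ ⟩
  eqb x y + (sNodes l + sNodes r)        ≡⟨ cong (λ m → eqb x y + m) (cong₂ _+_
                                              (sNodes≡ΣsAt D l dc-l (≤-trans (m≤m⊔n x y) x⊔y≤))
                                              (sNodes≡ΣsAt D r dc-r (≤-trans (m≤n⊔m x y) x⊔y≤))) ⟩
  eqb x y + (S x + S y)                  ≡⟨ balanced-sym (λ u v → eqb u v + (S u + S v))
                                              (λ u v → cong₂ _+_ (eqb-sym u v) (+-comm (S u) (S v))) x≤ y≤ ⟩
  sAt 0 n + (S ⌈ n /2⌉ + S ⌊ n /2⌋)      ≡⟨ cong (λ m → sAt 0 n + m) (sum-applyUpTo-+ _ _ D) ⟨
  sAt 0 n + sum (applyUpTo (λ d → sAt d ⌈ n /2⌉ + sAt d ⌊ n /2⌋) D)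
                                         ≡⟨ cong (λ m → sAt 0 n + m) (sum-applyUpTo-cong D (λ d _ → sAt-suc d 2≤n)) ⟨
  sum (applyUpTo (λ d → sAt d n) (suc D)) ∎
  where
  open ≡-Reasoning
  x = leaves l
  y = leaves r
  n = x + y
  S : ℕ → ℕ
  S m = sum (applyUpTo (λ d → sAt d m) D)
  2≤n : 2 ≤ n
  2≤n = +-mono-≤ (leaves≥1 l) (leaves≥1 r)
  x⊔y≤ : x ⊔ y ≤ 2 ^ D
  x⊔y≤ = subst₂ _≤_ (sym (balanced-⊔≡⌈/2⌉ x≤ y≤)) (⌈2^[1+d]/2⌉≡2^d D) (⌈n/2⌉-mono n≤)

2^⌊log2⌋≤n : ∀ n (rec : Acc _<_ n) → 1 ≤ n → 2 ^ ⌊log2⌋ n rec ≤ n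
2^⌊log2⌋≤n (suc zero)          _        _ = ≤-refl
2^⌊log2⌋≤n n@(suc (suc m)) (acc rs) _ = begin
  2 * 2 ^ ⌊log2⌋ ⌊ n /2⌋ _  ≤⟨ *-monoʳ-≤ 2 (2^⌊log2⌋≤n ⌊ n /2⌋ _ (s≤s z≤n)) ⟩
  2 * ⌊ n /2⌋               ≡⟨ cong (λ m → ⌊ n /2⌋ + m) (+-identityʳ ⌊ n /2⌋) ⟩
  ⌊ n /2⌋ + ⌊ n /2⌋        ≤⟨ +-monoʳ-≤ ⌊ n /2⌋ (⌊n/2⌋≤⌈n/2⌉ n) ⟩
  ⌊ n /2⌋ + ⌈ n /2⌉        ≡⟨ ⌊n/2⌋+⌈n/2⌉≡n n ⟩
  n                         ∎
  where open ≤-Reasoning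

2^⌊log₂n⌋≤n : ∀ n → 1 ≤ n → 2 ^ ⌊log₂ n ⌋ ≤ n
2^⌊log₂n⌋≤n n = 2^⌊log2⌋≤n n _

n<2^[1+⌊log₂n⌋] : ∀ n → n < 2 ^ suc ⌊log₂ n ⌋
n<2^[1+⌊log₂n⌋] n = ≰⇒> λ 2^[1+L]≤n →
  1+n≰n (subst (_≤ ⌊log₂ n ⌋) (⌊log₂[2^n]⌋≡n _) (⌊log₂⌋-mono-≤ 2^[1+L]≤n))

σ≡Σβ : ∀ t → IsDC t → sNodes t ≡ Σlog (leaves t) (λ i → β i (leaves t))
σ≡Σβ t dc = begin
  sNodes t                                 ≡⟨ sNodes≡ΣsAt (suc L) t dc (<⇒≤ (n<2^[1+⌊log₂n⌋] n)) ⟩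
  sum (applyUpTo (λ d → sAt d n) (suc L))  ≡⟨ sum-applyUpTo-cong (suc L) sAt≡β-below ⟩
  sum (applyUpTo (λ d → β d n) (suc L))    ≡⟨ cong sum (map-upTo (λ d → β d n) (suc L)) ⟨
  Σlog n (λ i → β i n)                     ∎
  where
  open ≡-Reasoning
  n = leaves t
  L = ⌊log₂ n ⌋
  sAt≡β-below : ∀ d → d < suc L → sAt d n ≡ β d n
  sAt≡β-below d d≤L = sAt≡β d n (≤-trans (^-monoʳ-≤ 2 (≤-pred d≤L)) (2^⌊log₂n⌋≤n n (leaves≥1 t)))

explicitTerm-β′ : ∀ q {i r} → r ≤ 2 ^ i →
  + ((q + 1) % 2) ℤ.* + (2 ^ i) ℤ.+ (ℤ.-[1+ 0 ] ℤ.^ ((q + 1) % 2)) ℤ.* + r ≡ + β′ (q % 2) i r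
explicitTerm-β′ zero          {i} {r} r≤ =
  trans (cong₂ ℤ._+_ (ℤP.*-identityˡ (+ (2 ^ i))) (ℤP.-1*i≡-i (+ r)))
        (trans (ℤP.m-n≡m⊖n (2 ^ i) r) (ℤP.⊖-≥ r≤))
explicitTerm-β′ (suc zero)    {i} {r} _  =
  trans (cong₂ ℤ._+_ (ℤP.*-zeroˡ (+ (2 ^ i))) (ℤP.*-identityˡ (+ r))) (ℤP.+-identityˡ (+ r))
explicitTerm-β′ (suc (suc q))          r≤ = explicitTerm-β′ q r≤

explicitTerm≡β : ∀ n i → explicitTerm n i ≡ + β i n
explicitTerm≡β n i = trans (explicitTerm-β′ (n div2^ i) (<⇒≤ (m%n<n n (2 ^ i))))
                           (cong +_ (sym (β≡β′ i n)))
  where instance 2^i≢0 = m^n≢0 2 i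

ΣlogZ-+ : ∀ n (f : ℕ → ℕ) → ΣlogZ n (λ i → + f i) ≡ + Σlog n f
ΣlogZ-+ n f = foldr-+ (upTo (suc ⌊log₂ n ⌋))
  where
  foldr-+ : ∀ xs → foldr ℤ._+_ (+ 0) (map (λ i → + f i) xs) ≡ + sum (map f xs)
  foldr-+ []       = refl
  foldr-+ (x ∷ xs) = cong (λ m → + f x ℤ.+ m) (foldr-+ xs)

ΣlogZ-explicitTerm : ∀ n → ΣlogZ n (explicitTerm n) ≡ + Σlog n (λ i → β i n)
ΣlogZ-explicitTerm n = begin
  ΣlogZ n (explicitTerm n)  ≡⟨ cong (foldr ℤ._+_ (+ 0)) (map-cong (explicitTerm≡β n) (upTo (suc ⌊log₂ n ⌋))) ⟩
  ΣlogZ n (λ i → + β i n)   ≡⟨ ΣlogZ-+ n (λ i → β i n) ⟩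
  + Σlog n (λ i → β i n)    ∎
  where open ≡-Reasoning

theorem51 : (n : ℕ) → 1 ≤ n → (t : Tree) → IsDC t → leaves t ≡ n →
    (sNodes t ≡ Σlog n (λ i → β i n)) × (+ (sNodes t) ≡ ΣlogZ n (explicitTerm n))
theorem51 .(leaves t) _ t dc refl =
  σ≡Σβ t dc , trans (cong +_ (σ≡Σβ t dc)) (sym (ΣlogZ-explicitTerm (leaves t)))
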